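{- Let $P$ and $Q$ be broken combs, and let $(P,x)$ and $(Q,x')$ be $n$-generated models based on them (over some finite set of variables). If $(P,x)$ and $(Q,x')$ are $3$-bisimilar, then they are fully bisimilar.
   Context: An $n$-comb is a poset on $P_0\sqcup P_1$ with $P_0=\{x_1,\dots,x_n\}$, $P_1=\{y_1,\dots,y_n\}$, ordered by: $y_i\le z$ iff $z=y_i$; and $x_i\le z$ iff $z=x_j$ with $i\le j$ or $z=y_j$ with $i\le j$ (so the $x_i$ form a chain and each $x_j$ has a "tooth" $y_j$ above it). A broken $n$-comb is a subposet of an $n$-comb containing $P_0$; a broken comb is a broken $n$-comb for some $n$. A model over a finite set $\overline{p}$ of variables is a rooted poset with root $x$ and an order-preserving coloring $c:P\to\mathcal{P}(\overline{p})$; it is $n$-generated if no two distinct points have bisimilar generated submodels. $k$-bisimilarity is given by relations $S_k\subseteq\dots\subseteq S_0$ linking the roots via $S_k$, $S_0$-related points having equal colors, and forth/back conditions passing from $S_{j+1}$ to $S_j$ along $\le$; bisimilarity is the usual notion. -}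

module Defs where

open import Data.Nat using (ℕ; zero; suc; _<_)
open import Data.Fin using (Fin) renaming (_≤_ to _≤ᶠ_)
open import Data.Fin.Subset using (Subset; _⊆_)
open import Data.Bool using (Bool; true)
open import Data.Product using (Σ; ∃; _×_; _,_; proj₁)
open import Relation.Binary.PropositionalEquality using (_≡_)
open import Data.Empty using (⊥)

record Kripke (m : ℕ) : Set₁ where
  field
    Carrier : Set
    _≤_     : Carrier → Carrier → Set
    root    : Carrier
    col     : Carrier → Subset m

open Kripke public

gen : ∀ {m} (M : Kripke m) → (∀ w → _≤_ M w w) → Carrier M → Kripke m
gen M refl w = record
  { Carrier = Σ (Carrier M) (λ v → _≤_ M w v)
  ; _≤_     = λ u v → _≤_ M (proj₁ u) (proj₁ v)
  ; root    = w , refl w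
  ; col     = λ u → col M (proj₁ u)
  }

record Bisimulation {m} (M N : Kripke m) : Set₁ where
  field
    Z     : Carrier M → Carrier N → Set
    roots : Z (root M) (root N)
    atoms : ∀ u v → Z u v → col M u ≡ col N v
    forth : ∀ u v u' → Z u v → _≤_ M u u' →
            ∃ λ v' → _≤_ N v v' × Z u' v'
    back  : ∀ u v v' → Z u v → _≤_ N v v' →
            ∃ λ u' → _≤_ M u u' × Z u' v'

Bisimilar : ∀ {m} → Kripke m → Kripke m → Set₁
Bisimilar M N = Bisimulation M N

-- k-bisimulation: relations S k ⊆ S (k-1) ⊆ … ⊆ S 0
-- (only the values S 0, …, S k are relevant).
record KBisimulation {m} (k : ℕ) (M N : Kripke m) : Set₁ where
  field
    S      : ℕ → Carrier M → Carrier N → Set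
    nested : ∀ j → j < k → ∀ u v → S (suc j) u v → S j u v
    roots  : S k (root M) (root N)
    atoms  : ∀ u v → S 0 u v → col M u ≡ col N v
    forth  : ∀ j → j < k → ∀ u v u' → S (suc j) u v → _≤_ M u u' →
             ∃ λ v' → _≤_ N v v' × S j u' v'
    back   : ∀ j → j < k → ∀ u v v' → S (suc j) u v → _≤_ N v v' →
             ∃ λ u' → _≤_ M u u' × S j u' v'

KBisimilar : ∀ {m} → ℕ → Kripke m → Kripke m → Set₁
KBisimilar k M N = KBisimulation k M N

Generated : ∀ {m} (M : Kripke m) → (∀ w → _≤_ M w w) → Set₁
Generated M refl = ∀ u v → Bisimilar (gen M refl u) (gen M refl v) → u ≡ v

-- Broken combs.  A broken n-comb is given by the set T of present teeth:
-- all x_i (i : Fin n), and y_i for those i with T i ≡ true.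

data CombPt (n : ℕ) (T : Fin n → Bool) : Set where
  x : Fin n → CombPt n T
  y : (i : Fin n) → T i ≡ true → CombPt n T

_≼_ : ∀ {n T} → CombPt n T → CombPt n T → Set
x i   ≼ x j   = i ≤ᶠ j
x i   ≼ y j _ = i ≤ᶠ j
y i _ ≼ x j   = ⊥
y i _ ≼ y j _ = i ≡ j

≼-refl : ∀ {n T} (w : CombPt n T) → w ≼ w
≼-refl (x i)   = Data.Fin.Properties.≤-refl
  where import Data.Fin.Properties
≼-refl (y i _) = Relation.Binary.PropositionalEquality.refl
  where import Relation.Binary.PropositionalEquality

combKripke : ∀ {m} n (T : Fin n → Bool) → CombPt n T →
             (CombPt n T → Subset m) → Kripke m
combKripke n T r c = record
  { Carrier = CombPt n T ; _≤_ = _≼_ ; root = r ; col = c }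

record CombModel (m : ℕ) : Set₁ where
  field
    n         : ℕ
    T         : Fin n → Bool
    r         : CombPt n T
    c         : CombPt n T → Subset m
    rootLeast : ∀ w → r ≼ w
    colMono   : ∀ {u v} → u ≼ v → c u ⊆ c v

toKripke : ∀ {m} → CombModel m → Kripke m
toKripke M = combKripke (CombModel.n M) (CombModel.T M) (CombModel.r M) (CombModel.c M)

GeneratedCM : ∀ {m} → CombModel m → Set₁
GeneratedCM M = Generated (toKripke M) ≼-refl

{-# OPTIONS --safe #-}
-- Call the colour of a point together with the set of colours of the maximal points above it
-- its type.  A 2-bisimulation already relates only points of equal type, and in an n-generated
-- broken comb the type determines the order: v ≤ w as soon as v's colour is contained in w's
-- and every maximal colour above w also occurs above v.  Since the roots are least, 3-bisimilarity
-- lets every point of one model be matched at depth 2 by a point of the other, so equality of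
-- types is a full bisimulation.
module Submission where

open import Data.Nat using (ℕ; suc; z<s; s<s)
open import Data.Fin using (Fin; fromℕ)
import Data.Fin.Properties as Fin
open import Data.Fin.Subset using (Subset; _⊆_)
open import Data.Fin.Subset.Properties using (⊆-antisym; ⊆-trans)
open import Data.Bool using (true; false)
open import Data.Product using (∃; _×_; _,_; proj₁; proj₂; swap)
open import Data.Sum using (_⊎_; inj₁; inj₂)
open import Data.Unit using (⊤; tt)
open import Relation.Unary using (Pred; _≐_) renaming (_⊆_ to _⊆ₚ_)
open import Relation.Binary.PropositionalEquality
open import Defs

≼-trans : ∀ {n T} {a b d : CombPt n T} → a ≼ b → b ≼ d → a ≼ d
≼-trans {a = x _}   {x _}   {x _}   p q    = Fin.≤-trans p q
≼-trans {a = x _}   {x _}   {y _ _} p q    = Fin.≤-trans p q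
≼-trans {a = x _}   {y _ _} {y _ _} p refl = p
≼-trans {a = y _ _} {y _ _} {y _ _} refl q = q

IsMaximal : ∀ {n T} → CombPt n T → Set
IsMaximal w = ∀ w′ → w ≼ w′ → w′ ≼ w

y-maximal : ∀ {n T} i (p : T i ≡ true) → IsMaximal {n} {T} (y i p)
y-maximal i p (y j q) i≡j = sym i≡j

below-maximal : ∀ {n T} (z : CombPt n T) → ∃ λ w → z ≼ w × IsMaximal w
below-maximal (y i p) = y i p , refl , y-maximal i p
below-maximal {suc n} {T} (x i) with T (fromℕ n) in last
... | true  = y (fromℕ n) last , Fin.≤fromℕ i , y-maximal _ last
... | false = x (fromℕ n) , Fin.≤fromℕ i , x-last-maximal
  where
  x-last-maximal : IsMaximal (x (fromℕ n))
  x-last-maximal (x j)   _    = Fin.≤fromℕ j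
  x-last-maximal (y j q) last≤j
    with trans (sym last) (trans (cong T (Fin.≤-antisym last≤j (Fin.≤fromℕ j))) q)
  ... | ()

x-injective : ∀ {n T} {i j : Fin n} → x {n} {T} i ≡ x j → i ≡ j
x-injective refl = refl

ConstantAbove : ∀ {m} (M : Kripke m) → Carrier M → Subset m → Set
ConstantAbove M u s = ∀ z → _≤_ M u z → col M z ≡ s

constantAbove-bisimilar : ∀ {m} (M : Kripke m) (≤-refl : ∀ w → _≤_ M w w) {u v s} →
                          ConstantAbove M u s → ConstantAbove M v s →
                          Bisimilar (gen M ≤-refl u) (gen M ≤-refl v)
constantAbove-bisimilar M ≤-refl const-u const-v = record
  { Z     = λ _ _ → ⊤
  ; roots = tt
  ; atoms = λ (a , u≤a) (b , v≤b) _ → trans (const-u a u≤a) (sym (const-v b v≤b))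
  ; forth = λ _ (b , v≤b) _ _ _ → (b , v≤b) , ≤-refl b , tt
  ; back  = λ (a , u≤a) _ _ _ _ → (a , u≤a) , ≤-refl a , tt
  }

KBisimulation-sym : ∀ {m k} {M N : Kripke m} → KBisimulation k M N → KBisimulation k N M
KBisimulation-sym K = record
  { S      = λ j v u → S j u v
  ; nested = λ j j<k v u → nested j j<k u v
  ; roots  = roots
  ; atoms  = λ v u s → sym (atoms u v s)
  ; forth  = λ j j<k v u → back j j<k u v
  ; back   = λ j j<k v u → forth j j<k u v
  }
  where open KBisimulation K

module CombModelTypes {m} (M : CombModel m) where
  open CombModel M

  Point : Set
  Point = CombPt n T

  MaxColours : Point → Pred (Subset m) _
  MaxColours u s = ∃ λ w → u ≼ w × IsMaximal w × c w ≡ s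

  maxColours-antitone : ∀ {u u′} → u ≼ u′ → MaxColours u′ ⊆ₚ MaxColours u
  maxColours-antitone u≼u′ (w , u′≼w , max-w , e) = w , ≼-trans u≼u′ u′≼w , max-w , e

  maximal-constantAbove : ∀ {u} → IsMaximal u → ConstantAbove (toKripke M) u (c u)
  maximal-constantAbove max-u z u≼z = ⊆-antisym (colMono (max-u z u≼z)) (colMono u≼z)

  maximal-maxColours : ∀ {u} → IsMaximal u → MaxColours u ⊆ₚ (_≡ c u)
  maximal-maxColours max-u (w , u≼w , _ , e) = trans (sym e) (maximal-constantAbove max-u w u≼w)

  constantAbove-squeeze : ∀ {u s} → s ⊆ c u → MaxColours u ⊆ₚ (_≡ s) → ConstantAbove (toKripke M) u s
  constantAbove-squeeze s⊆u max-s z u≼z with below-maximal z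
  ... | w , z≼w , max-w =
    ⊆-antisym (subst (c z ⊆_) (max-s (w , ≼-trans u≼z z≼w , max-w , refl)) (colMono z≼w))
              (⊆-trans s⊆u (colMono u≼z))

  module Generated (gen-M : GeneratedCM M) where

    constantAbove-unique : ∀ {u v s} → ConstantAbove (toKripke M) u s →
                           ConstantAbove (toKripke M) v s → u ≡ v
    constantAbove-unique const-u const-v =
      gen-M _ _ (constantAbove-bisimilar (toKripke M) ≼-refl const-u const-v)

    maximal-colour-injective : ∀ {u v} → IsMaximal u → IsMaximal v → c u ≡ c v → u ≡ v
    maximal-colour-injective max-u max-v e =
      constantAbove-unique (subst (ConstantAbove (toKripke M) _) e (maximal-constantAbove max-u))
                           (maximal-constantAbove max-v)

    ≼-maximal : ∀ {v w} → IsMaximal w → MaxColours w ⊆ₚ MaxColours v → v ≼ w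
    ≼-maximal {v} {w} max-w w⊆v with w⊆v (w , ≼-refl w , max-w , refl)
    ... | w′ , v≼w′ , max-w′ , e = subst (v ≼_) (maximal-colour-injective max-w′ max-w e) v≼w′

    -- The colour is constant on the segment from x j to x i, and every tooth above x j is above x i.
    x-segment-bisimilar : ∀ {i j} → x {n} {T} j ≼ x i → c (x i) ⊆ c (x j) →
                          MaxColours (x j) ⊆ₚ MaxColours (x i) →
                          Bisimilar (gen (toKripke M) ≼-refl (x j)) (gen (toKripke M) ≼-refl (x i))
    x-segment-bisimilar {i} {j} j≤i i⊆j j⊆ᴹi = record
      { Z = Related ; roots = inj₂ (j≤i , refl) ; atoms = atoms ; forth = forth ; back = back }
      where
      Above : Point → Set
      Above u = ∃ (u ≼_)

      Related : Above (x j) → Above (x i) → Set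
      Related (a , _) (b , _) = a ≡ b ⊎ (a ≼ x i × b ≡ x i)

      tooth-above-x-i : ∀ k (q : T k ≡ true) → x {n} {T} j ≼ y k q → x i ≼ y {n} {T} k q
      tooth-above-x-i k q j≤k = ≼-maximal (y-maximal k q) (λ e → j⊆ᴹi (maxColours-antitone j≤k e))

      atoms : ∀ u v → Related u v → c (proj₁ u) ≡ c (proj₁ v)
      atoms _ _ (inj₁ refl) = refl
      atoms (a , j≼a) _ (inj₂ (a≼i , refl)) = ⊆-antisym (colMono a≼i) (⊆-trans i⊆j (colMono j≼a))

      forth : ∀ u v u′ → Related u v → proj₁ u ≼ proj₁ u′ →
              ∃ λ v′ → proj₁ v ≼ proj₁ v′ × Related u′ v′
      forth _ (_ , i≼b) (a′ , _) (inj₁ refl) a≼a′ = (a′ , ≼-trans i≼b a≼a′) , a≼a′ , inj₁ refl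
      forth _ _ (y k q , j≼k) (inj₂ (_ , refl)) _ =
        (y k q , tooth-above-x-i k q j≼k) , tooth-above-x-i k q j≼k , inj₁ refl
      forth _ (_ , i≼i) (x k , _) (inj₂ (_ , refl)) _ with Fin.≤-total k i
      ... | inj₁ k≤i = (x i , i≼i) , ≼-refl (x {n} {T} i) , inj₂ (k≤i , refl)
      ... | inj₂ i≤k = (x k , i≤k) , i≤k , inj₁ refl

      back : ∀ u v v′ → Related u v → proj₁ v ≼ proj₁ v′ →
             ∃ λ u′ → proj₁ u ≼ proj₁ u′ × Related u′ v′
      back (_ , j≼a) _ (b′ , _) (inj₁ refl) a≼b′ = (b′ , ≼-trans j≼a a≼b′) , a≼b′ , inj₁ refl
      back _ _ (b′ , i≼b′) (inj₂ (a≼i , refl)) _ =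
        (b′ , ≼-trans {a = x j} j≤i i≼b′) , ≼-trans a≼i i≼b′ , inj₁ refl

    ≼-of-types : ∀ {v w} → c v ⊆ c w → MaxColours w ⊆ₚ MaxColours v → v ≼ w
    ≼-of-types {w = y k q} _ w⊆ᴹv = ≼-maximal (y-maximal k q) w⊆ᴹv
    ≼-of-types {y i p} {x j} v⊆w w⊆ᴹv
      with constantAbove-unique
             (constantAbove-squeeze {x j} v⊆w (λ e → maximal-maxColours (y-maximal i p) (w⊆ᴹv e)))
             (maximal-constantAbove (y-maximal i p))
    ... | ()
    ≼-of-types {x i} {x j} i⊆j j⊆ᴹi with Fin.≤-total i j
    ... | inj₁ i≤j = i≤j
    ... | inj₂ j≤i = Fin.≤-reflexive (sym (x-injective (gen-M _ _ (x-segment-bisimilar j≤i i⊆j j⊆ᴹi))))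

open CombModelTypes using (Point; MaxColours; maxColours-antitone; maximal-constantAbove)
open CombModelTypes.Generated using (≼-of-types)

record SameType {m} (P Q : CombModel m) (u : Point P) (v : Point Q) : Set where
  constructor _,_
  field
    colour     : CombModel.c P u ≡ CombModel.c Q v
    maxColours : MaxColours P u ≐ MaxColours Q v

sameType-sym : ∀ {m} {P Q : CombModel m} {u v} → SameType P Q u v → SameType Q P v u
sameType-sym (cu≡cv , u≐v) = sym cu≡cv , swap u≐v

module _ {m k} {P Q : CombModel m} (K : KBisimulation (suc (suc k)) (toKripke P) (toKripke Q)) where
  open KBisimulation K

  S₂⇒maxColours : ∀ {u v} → S 2 u v → MaxColours P u ⊆ₚ MaxColours Q v
  S₂⇒maxColours {u} {v} s₂ (w , u≼w , max-w , e) with forth 1 (s<s z<s) u v w s₂ u≼w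
  ... | w′ , v≼w′ , s₁ with below-maximal w′
  ... | w″ , w′≼w″ , max-w″ with back 0 z<s w w′ w″ s₁ w′≼w″
  ... | w₁ , w≼w₁ , s₀ =
    w″ , ≼-trans v≼w′ w′≼w″ , max-w″ ,
    trans (sym (atoms w₁ w″ s₀)) (trans (maximal-constantAbove P max-w w₁ w≼w₁) e)

S₂⇒sameType : ∀ {m k} {P Q : CombModel m} (K : KBisimulation (suc (suc k)) (toKripke P) (toKripke Q)) →
              ∀ {u v} → KBisimulation.S K 2 u v → SameType P Q u v
S₂⇒sameType {P = P} {Q} K {u} {v} s₂ =
  atoms u v (nested 0 z<s u v (nested 1 (s<s z<s) u v s₂)) ,
  (S₂⇒maxColours {P = P} {Q} K s₂ , S₂⇒maxColours {P = Q} {P} (KBisimulation-sym K) s₂)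
  where open KBisimulation K

sameType-forth : ∀ {m} {P Q : CombModel m} → GeneratedCM Q → KBisimulation 3 (toKripke P) (toKripke Q) →
                 ∀ u v u′ → SameType P Q u v → u ≼ u′ → ∃ λ v′ → v ≼ v′ × SameType P Q u′ v′
sameType-forth {P = P} {Q} gen-Q K u v u′ (cu≡cv , u≐v) u≼u′
  with KBisimulation.forth K 2 (s<s (s<s z<s)) _ _ u′ (KBisimulation.roots K) (CombModel.rootLeast P u′)
... | v′ , _ , s₂ with S₂⇒sameType {P = P} {Q} K s₂
... | cu′≡cv′ , u′≐v′ = v′ , ≼-of-types Q gen-Q v⊆v′ v′⊆ᴹv , (cu′≡cv′ , u′≐v′)
  where
  v⊆v′ : CombModel.c Q v ⊆ CombModel.c Q v′
  v⊆v′ = subst₂ _⊆_ cu≡cv cu′≡cv′ (CombModel.colMono P u≼u′)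
  v′⊆ᴹv : MaxColours Q v′ ⊆ₚ MaxColours Q v
  v′⊆ᴹv e = proj₁ u≐v (maxColours-antitone P u≼u′ (proj₂ u′≐v′ e))

mainTheorem8 : ∀ (m : ℕ) (P Q : CombModel m) →
                 GeneratedCM P → GeneratedCM Q →
                 KBisimilar 3 (toKripke P) (toKripke Q) →
                 Bisimilar (toKripke P) (toKripke Q)
mainTheorem8 m P Q gen-P gen-Q K = record
  { Z     = SameType P Q
  ; roots = S₂⇒sameType K (nested 2 (s<s (s<s z<s)) _ _ roots)
  ; atoms = λ _ _ → SameType.colour
  ; forth = sameType-forth gen-Q K
  ; back  = back
  }
  where
  open KBisimulation K using (nested; roots)
  back : ∀ u v v′ → SameType P Q u v → v ≼ v′ → ∃ λ u′ → u ≼ u′ × SameType P Q u′ v′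
  back u v v′ same v≼v′ with sameType-forth gen-P (KBisimulation-sym K) v u v′ (sameType-sym same) v≼v′
  ... | u′ , u≼u′ , same′ = u′ , u≼u′ , sameType-sym same′
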